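{- Let ${\tt C}$ be a $\mu$Stipula$^{\tt DI}$ contract and ${\tt C}({\tt Q},\Sigma,\Psi)$ a configuration of ${\tt C}$. Then: (i) if ${\tt Q}\notin\mathtt{InitEv}({\tt C})$ or $\Sigma\neq\_$, then for every configuration $\mathbb{C}$, ${\tt C}({\tt Q},\Sigma,\Psi)\to\mathbb{C}$ iff ${\tt C}({\tt Q},\Sigma,\Psi)\to_{\tt tp}\mathbb{C}$; (ii) if ${\tt Q}\in\mathtt{InitEv}({\tt C})$ and $\Psi = 0\gg_n{\tt Q}\Rightarrow{\tt Q}'\,|\,\Psi'$ for some $n,{\tt Q}',\Psi'$, then for every $\mathbb{C}$, ${\tt C}({\tt Q},\_,\Psi)\to\mathbb{C}$ iff ${\tt C}({\tt Q},\_,\Psi)\to_{\tt tp}\mathbb{C}$; (iii) if ${\tt Q}\in\mathtt{InitEv}({\tt C})$ and $\mathit{nored}(\Psi,{\tt Q})$, then ${\tt C}({\tt Q},\_,\Psi)$ is stuck iff ${\tt C}({\tt Q},\_,\Psi)$ has no $\to_{\tt tp}$ transition.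
   Context: A $\mu$Stipula contract ${\tt C}$ consists of a finite set of states, an initial state ${\tt Q}_{\rm init}$, and a finite set of functions $@{\tt Q}\; {\tt f}\,\{W\} \Rightarrow @{\tt Q}'$, where $W$ is a finite sequence of events ${\tt now}+k \gg @{\tt Q}_1 \Rightarrow @{\tt Q}_2$ ($k\in\mathbb N$; ${\tt Q}_1$ is the event's initial state), each event occurrence carrying a unique line index $n$. A pending event is $k \gg_n {\tt Q}_1 \Rightarrow {\tt Q}_2$. A configuration is ${\tt C}({\tt Q},\Sigma,\Psi)$ with ${\tt Q}$ a state, $\Psi$ a finite multiset of pending events (written with $|$, empty $\_$), and $\Sigma$ either empty ($\_$) or $\Psi'\Rightarrow{\tt Q}'$. (A clock incremented by Tick is also carried; it is irrelevant.) $\mathit{nored}(\Psi,{\tt Q})$ holds iff $\Psi$ has no pending event $0\gg_n {\tt Q}\Rightarrow {\tt Q}'$; $\Psi\!\downarrow$ deletes pending events with time $0$ and decrements all others. The relation $\to$ is given by: (Function) if $@{\tt Q}\,{\tt f}\{W\}\Rightarrow@{\tt Q}'$ is in ${\tt C}$ and $\mathit{nored}(\Psi,{\tt Q})$, then ${\tt C}({\tt Q},\_,\Psi)\to{\tt C}({\tt Q},\Psi_W\Rightarrow{\tt Q}',\Psi)$, with $\Psi_W$ the multiset of $k\gg_n{\tt Q}_1\Rightarrow{\tt Q}_2$ for the events of $W$; (State-Change) ${\tt C}({\tt Q},\Psi'\Rightarrow{\tt Q}',\Psi)\to{\tt C}({\tt Q}',\_,\Psi'|\Psi)$; (Event-Match)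 ${\tt C}({\tt Q},\_,0\gg_n{\tt Q}\Rightarrow{\tt Q}'\,|\,\Psi')\to{\tt C}({\tt Q},\_\Rightarrow{\tt Q}',\Psi')$; (Tick) if $\mathit{nored}(\Psi,{\tt Q})$ then ${\tt C}({\tt Q},\_,\Psi)\to{\tt C}({\tt Q},\_,\Psi\!\downarrow)$. Let $\mathtt{InitEv}({\tt C})$ be the set of initial states of events in ${\tt C}$. The relation $\to_{\tt tp}$ is defined by the same rules except that Tick is replaced by (Tick-Plus): if ${\tt Q}\notin\mathtt{InitEv}({\tt C})$ then ${\tt C}({\tt Q},\_,\Psi)\to_{\tt tp}{\tt C}({\tt Q},\_,\Psi\!\downarrow)$. A configuration $\mathbb{C}$ is stuck if every computation $\mathbb{C}\to^*\mathbb{C}'$ consists only of Tick transitions. $\mu$Stipula$^{\tt DI}$ is the fragment of contracts in which every event has time expression ${\tt now}+0$ and no state is both the initial state of a function and the initial state of an event. -}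

module Defs where

open import Data.Nat using (ℕ; zero; suc; _≤_)
open import Data.Fin using (Fin)
open import Data.List using (List; []; _∷_; _++_; map; concatMap)
open import Data.List.Relation.Unary.Any using (Any)
open import Data.List.Relation.Unary.All using (All)
open import Data.List.Relation.Unary.Unique.Propositional using (Unique)
open import Data.List.Membership.Propositional using (_∈_)
open import Data.List.Relation.Binary.Permutation.Propositional using (_↭_)
open import Data.Maybe using (Maybe; just; nothing)
open import Data.Product using (Σ; ∃; _×_; _,_)
open import Relation.Binary.PropositionalEquality using (_≡_)
open import Relation.Nullary using (¬_)

-- an event  now + time ≫ @from ⇒ @to  occurring at line `line`
record Event (nst : ℕ) : Set where
  constructor ev
  field
    time : ℕ
    line : ℕ
    from : Fin nst
    to   : Fin nst

record Function (nst : ℕ) : Set where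
  constructor fun
  field
    src  : Fin nst
    name : ℕ
    body : List (Event nst)
    tgt  : Fin nst

open Event public
open Function public

allEvents : ∀ {nst} → List (Function nst) → List (Event nst)
allEvents = concatMap body

record Contract : Set where
  field
    nst   : ℕ
    init  : Fin nst
    funs  : List (Function nst)
    linesUnique : Unique (map line (allEvents funs))

open Contract public

State : Contract → Set
State C = Fin (nst C)

InitEv : (C : Contract) → State C → Set
InitEv C Q = Any (λ e → from e ≡ Q) (allEvents (funs C))

InitFun : (C : Contract) → State C → Set
InitFun C Q = Any (λ f → src f ≡ Q) (funs C)

DI : Contract → Set
DI C = All (λ e → time e ≡ 0) (allEvents (funs C))
     × (∀ Q → ¬ (InitFun C Q × InitEv C Q))

record Pending (nst : ℕ) : Set where
  constructor pe
  field
    ptime : ℕ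
    pline : ℕ
    pfrom : Fin nst
    pto   : Fin nst

open Pending public

PMultiset : ℕ → Set
PMultiset nst = List (Pending nst)   -- considered up to _↭_

instantiate : ∀ {nst} → List (Event nst) → PMultiset nst
instantiate = map (λ e → pe (time e) (line e) (from e) (to e))

-- Σ : either _ (nothing) or Ψ' ⇒ Q' (just (Ψ' , Q'))
SigmaC : ℕ → Set
SigmaC nst = Maybe (PMultiset nst × Fin nst)

record Config (C : Contract) : Set where
  constructor cfg
  field
    state : State C
    sigma : SigmaC (nst C)
    psi   : PMultiset (nst C)
    clock : ℕ

nored : ∀ {nst} → PMultiset nst → Fin nst → Set
nored Ψ Q = ¬ Any (λ p → ptime p ≡ 0 × pfrom p ≡ Q) Ψ

tickDown : ∀ {nst} → PMultiset nst → PMultiset nst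
tickDown [] = []
tickDown (pe zero n q q' ∷ Ψ) = tickDown Ψ
tickDown (pe (suc k) n q q' ∷ Ψ) = pe k n q q' ∷ tickDown Ψ

PendingOf : (C : Contract) → Pending (nst C) → Set
PendingOf C p = Any (λ e → line e ≡ pline p × from e ≡ pfrom p × to e ≡ pto p
                         × ptime p ≤ time e) (allEvents (funs C))

SigmaOf : (C : Contract) → SigmaC (nst C) → Set
SigmaOf C nothing = Data.Unit.⊤ where import Data.Unit
SigmaOf C (just (Ψ' , Q')) = All (PendingOf C) Ψ'

ConfigOf : (C : Contract) → Config C → Set
ConfigOf C (cfg Q Σ' Ψ t) = SigmaOf C Σ' × All (PendingOf C) Ψ

data Mode : Set where
  standard tickPlus : Mode

data Label : Set where
  lFunction lStateChange lEventMatch lTick : Label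

data Step (C : Contract) : Mode → Config C → Label → Config C → Set where
  function : ∀ {m Q Ψ Ψ₁ Ψw t} {f : Function (nst C)} →
    f ∈ funs C → src f ≡ Q → nored Ψ Q →
    Ψw ↭ instantiate (body f) → Ψ₁ ↭ Ψ →
    Step C m (cfg Q nothing Ψ t) lFunction (cfg Q (just (Ψw , tgt f)) Ψ₁ t)
  stateChange : ∀ {m Q Q' Ψ' Ψ Ψ₂ t} →
    Ψ₂ ↭ (Ψ' ++ Ψ) →
    Step C m (cfg Q (just (Ψ' , Q')) Ψ t) lStateChange (cfg Q' nothing Ψ₂ t)
  eventMatch : ∀ {m Q Q' n Ψ Ψ' t} →
    Ψ ↭ (pe 0 n Q Q' ∷ Ψ') →
    Step C m (cfg Q nothing Ψ t) lEventMatch (cfg Q (just ([] , Q')) Ψ' t)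
  tick : ∀ {Q Ψ Ψ₁ t} →
    nored Ψ Q → Ψ₁ ↭ tickDown Ψ →
    Step C standard (cfg Q nothing Ψ t) lTick (cfg Q nothing Ψ₁ (suc t))
  tick-plus : ∀ {Q Ψ Ψ₁ t} →
    ¬ InitEv C Q → Ψ₁ ↭ tickDown Ψ →
    Step C tickPlus (cfg Q nothing Ψ t) lTick (cfg Q nothing Ψ₁ (suc t))

_⟶[_]_ : ∀ {C} → Config C → Mode → Config C → Set
_⟶[_]_ {C} c m c' = ∃ λ ℓ → Step C m c ℓ c'

data Steps (C : Contract) (m : Mode) : Config C → List Label → Config C → Set where
  []  : ∀ {c} → Steps C m c [] c
  _∷_ : ∀ {c c' c'' ℓ ls} → Step C m c ℓ c' → Steps C m c' ls c'' →
        Steps C m c (ℓ ∷ ls) c''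

Stuck : (C : Contract) → Config C → Set
Stuck C c = ∀ ls c' → Steps C standard c ls c' → All (_≡ lTick) ls

{-# OPTIONS --safe #-}
module Submission where

-- The two transition relations differ only in the guard of the tick rule:
-- nored Ψ Q for →, Q ∉ InitEv for →tp.  In (i) and (ii) these guards agree:
-- a pending event of C whose source is not event-initial is never a redex,
-- and an enabled event falsifies nored.  In (iii), DI rules out functions at
-- Q, and since all residual times are 0 a standard tick empties Ψ, after
-- which only ticks remain.

open import Defs
open import Data.Nat using (ℕ)
open import Data.Nat.Properties using (n≤0⇒n≡0)
open import Data.List using ([]; _∷_)
open import Data.List.Relation.Binary.Permutation.Propositional using (_↭_; ↭-sym)
open import Data.List.Relation.Binary.Permutation.Propositional.Properties
  using (Any-resp-↭; ↭-empty-inv)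
open import Data.List.Relation.Unary.Any using (here)
import Data.List.Relation.Unary.Any as Any
open import Data.List.Relation.Unary.All using (All; []; _∷_; lookupWith)
import Data.List.Relation.Unary.All as All
open import Data.List.Membership.Propositional using (_∈_)
open import Data.Maybe using (nothing)
open import Data.Product using (_×_; ∃; _,_; proj₁; proj₂)
open import Data.Sum using (_⊎_; [_,_]′)
open import Data.Empty using (⊥-elim)
open import Function.Base using (const; _∘_)
open import Function.Bundles using (_⇔_; mk⇔; Equivalence)
open import Relation.Binary.PropositionalEquality using (_≢_; _≡_; refl; subst)
open import Relation.Nullary using (¬_)

module _ (C : Contract) where

  PendingOf⇒InitEv : ∀ {p} → PendingOf C p → InitEv C (pfrom p)
  PendingOf⇒InitEv = Any.map (λ (_ , from≡ , _) → from≡)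

  ¬InitEv⇒nored : ∀ {Q Ψ} → ¬ InitEv C Q → All (PendingOf C) Ψ → nored Ψ Q
  ¬InitEv⇒nored ¬init pending redex =
    ¬init (lookupWith (λ p-of (_ , from≡Q) → subst (InitEv C) from≡Q (PendingOf⇒InitEv p-of))
                      pending redex)

  ↭-redex⇒¬nored : ∀ {Q Q' : State C} {n Ψ Ψ'} → Ψ ↭ pe 0 n Q Q' ∷ Ψ' → ¬ nored Ψ Q
  ↭-redex⇒¬nored Ψ↭ nr = nr (Any-resp-↭ (↭-sym Ψ↭) (here (refl , refl)))

  tickDown-ptime≡0 : {Ψ : PMultiset (nst C)} → All (λ p → ptime p ≡ 0) Ψ → tickDown Ψ ≡ []
  tickDown-ptime≡0 [] = refl
  tickDown-ptime≡0 {pe _ _ _ _ ∷ _} (refl ∷ zeros) = tickDown-ptime≡0 zeros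

  module _ (di : DI C) where

    DI⇒ptime≡0 : ∀ {Ψ} → All (PendingOf C) Ψ → All (λ p → ptime p ≡ 0) Ψ
    DI⇒ptime≡0 = All.map (lookupWith (λ { refl (_ , _ , _ , p≤0) → n≤0⇒n≡0 p≤0 }) (proj₁ di))

    DI⇒InitEv⇒¬InitFun : ∀ {Q f} → InitEv C Q → f ∈ funs C → src f ≢ Q
    DI⇒InitEv⇒¬InitFun init f∈ refl = proj₂ di _ (Any.map (λ { refl → refl }) f∈ , init)

    InitEv⇒nored⇒¬⟶tp : ∀ {Q Ψ t} {K : Config C} → InitEv C Q → nored Ψ Q →
      ¬ (cfg Q nothing Ψ t ⟶[ tickPlus ] K)
    InitEv⇒nored⇒¬⟶tp init _  (_ , function f∈ src≡ _ _ _) = DI⇒InitEv⇒¬InitFun init f∈ src≡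
    InitEv⇒nored⇒¬⟶tp _    nr (_ , eventMatch Ψ↭)        = ↭-redex⇒¬nored Ψ↭ nr
    InitEv⇒nored⇒¬⟶tp init _  (_ , tick-plus ¬init _)    = ¬init init

    InitEv⇒nored⇒only-ticks : ∀ {Q Ψ t ls K} → InitEv C Q →
      All (λ p → ptime p ≡ 0) Ψ → nored Ψ Q →
      Steps C standard (cfg Q nothing Ψ t) ls K → All (_≡ lTick) ls
    InitEv⇒nored⇒only-ticks _ _ _ [] = []
    InitEv⇒nored⇒only-ticks init _ _ (function f∈ src≡ _ _ _ ∷ _) =
      ⊥-elim (DI⇒InitEv⇒¬InitFun init f∈ src≡)
    InitEv⇒nored⇒only-ticks _ _ nr (eventMatch Ψ↭ ∷ _) = ⊥-elim (↭-redex⇒¬nored Ψ↭ nr)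
    InitEv⇒nored⇒only-ticks init zeros _ (tick _ Ψ₁↭ ∷ rest)
      with refl ← ↭-empty-inv (subst (_ ↭_) (tickDown-ptime≡0 zeros) Ψ₁↭) =
      refl ∷ InitEv⇒nored⇒only-ticks init [] (λ ()) rest

  ⟶-standard⇔tickPlus : ∀ {Q Σ' Ψ t} → (Σ' ≡ nothing → nored Ψ Q ⇔ (¬ InitEv C Q)) →
    ∀ (K : Config C) → (cfg Q Σ' Ψ t ⟶[ standard ] K) ⇔ (cfg Q Σ' Ψ t ⟶[ tickPlus ] K)
  ⟶-standard⇔tickPlus guards K = mk⇔ standard⇒tickPlus tickPlus⇒standard
    where
    standard⇒tickPlus : _ ⟶[ standard ] K → _ ⟶[ tickPlus ] K
    standard⇒tickPlus (_ , function f∈ src≡ nr W↭ Ψ↭) = _ , function f∈ src≡ nr W↭ Ψ↭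
    standard⇒tickPlus (_ , stateChange Ψ↭)           = _ , stateChange Ψ↭
    standard⇒tickPlus (_ , eventMatch Ψ↭)            = _ , eventMatch Ψ↭
    standard⇒tickPlus (_ , tick nr Ψ↭)               = _ , tick-plus (Equivalence.to (guards refl) nr) Ψ↭
    tickPlus⇒standard : _ ⟶[ tickPlus ] K → _ ⟶[ standard ] K
    tickPlus⇒standard (_ , function f∈ src≡ nr W↭ Ψ↭) = _ , function f∈ src≡ nr W↭ Ψ↭
    tickPlus⇒standard (_ , stateChange Ψ↭)           = _ , stateChange Ψ↭
    tickPlus⇒standard (_ , eventMatch Ψ↭)            = _ , eventMatch Ψ↭
    tickPlus⇒standard (_ , tick-plus ¬init Ψ↭)       = _ , tick (Equivalence.from (guards refl) ¬init) Ψ↭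

proposition1 : (C : Contract) → DI C →
    (Q : State C) (Σ' : SigmaC (nst C)) (Ψ : PMultiset (nst C)) (t : ℕ) →
    ConfigOf C (cfg Q Σ' Ψ t) →
      ((¬ InitEv C Q ⊎ Σ' ≢ nothing) →
         ∀ (K : Config C) → (cfg Q Σ' Ψ t ⟶[ standard ] K) ⇔ (cfg Q Σ' Ψ t ⟶[ tickPlus ] K))
    × (InitEv C Q → ∀ n Q' Ψ' → Ψ ↭ (pe 0 n Q Q' ∷ Ψ') →
         ∀ (K : Config C) → (cfg Q nothing Ψ t ⟶[ standard ] K) ⇔ (cfg Q nothing Ψ t ⟶[ tickPlus ] K))
    × (InitEv C Q → nored Ψ Q →
         Stuck C (cfg Q nothing Ψ t) ⇔ (¬ ∃ λ (K : Config C) → cfg Q nothing Ψ t ⟶[ tickPlus ] K))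
proposition1 C di Q Σ' Ψ t (_ , pending) =
    [ (λ ¬init → ⟶-standard⇔tickPlus C λ _ →
         mk⇔ (const ¬init) (const (¬InitEv⇒nored C ¬init pending)))
    , (λ Σ'≢nothing → ⟶-standard⇔tickPlus C (⊥-elim ∘ Σ'≢nothing))
    ]′
  , (λ init _ _ _ Ψ↭ → ⟶-standard⇔tickPlus C λ _ →
       mk⇔ (⊥-elim ∘ ↭-redex⇒¬nored C Ψ↭) (λ ¬init → ⊥-elim (¬init init)))
  , (λ init nr → mk⇔
       (const (λ (_ , step) → InitEv⇒nored⇒¬⟶tp C di init nr step))
       (const (λ _ _ → InitEv⇒nored⇒only-ticks C di init (DI⇒ptime≡0 C di pending) nr)))
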